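{- Under the standing assumptions below, for every $i\in\{1,2,\dots,n\}$, \[\theta_i-\Delta_{n,q}q^{i-1}+1\leq U(n,i,q),\] with equality if $i=1$.
   Context: Standing assumptions: $p$ is a prime, $q=p^h$ with $h\geq 2$, $n\geq 3$, and $q\geq\max\{32,2^{2n-4}\}$ if $h>2$, while $q\geq 2^{2n}$ if $h=2$. For integers $m\geq -1$, $\theta_m:=\frac{q^{m+1}-1}{q-1}$ (so $\theta_{ -1}=0$), and $\theta_{ -2}:=0$. For $i\in\{0,\dots,n\}$: $\Delta_{i,q}:=\left\lfloor\frac{1}{2^{i-2}}\sqrt{q}\right\rfloor$ if $h>2$ and $\Delta_{i,q}:=\left\lfloor\frac{p}{2^i}\right\rfloor$ if $h=2$; and \[U(n,i,q):=q^i-(\Delta_{n,q}-2)\lfloor q^{i-1}\rfloor-(i-2)\big((q-1)\Delta_{n,q}+1\big)\lfloor q^{i-3}\rfloor+\theta_{i-3}.\] -}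

module Defs where

open import Data.Nat as ℕ using (ℕ; zero; suc; _≡ᵇ_; _≤ᵇ_)
import Data.Nat.DivMod
open import Data.Nat.Properties using (m^n≢0)
open import Data.Bool using (if_then_else_)
open import Data.Integer as ℤ using (ℤ; +_; -[1+_])

isqrt : ℕ → ℕ
isqrt zero = zero
isqrt (suc m) with isqrt m
... | r = if (suc r ℕ.* suc r) ≤ᵇ suc m then suc r else r

-- Δ_{i,q} for q = p^h (h ≥ 2):
--   h > 2 : ⌊ √q / 2^(i-2) ⌋ = ⌊ √(16 q) / 2^i ⌋ = ⌊ ⌊√(16q)⌋ / 2^i ⌋
--   h = 2 : ⌊ p / 2^i ⌋
Δ : (p h q i : ℕ) → ℕ
Δ p h q i =
  if h ≡ᵇ 2
  then Data.Nat.DivMod._/_ p (2 ℕ.^ i) {{m^n≢0 2 i}}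
  else Data.Nat.DivMod._/_ (isqrt (16 ℕ.* q)) (2 ℕ.^ i) {{m^n≢0 2 i}}

geomSum : ℕ → ℕ → ℕ
geomSum q zero = 1
geomSum q (suc k) = geomSum q k ℕ.+ q ℕ.^ suc k

-- θ_m for integer m ≥ -2: θ_m = (q^(m+1)-1)/(q-1) for m ≥ 0, θ_{-1} = θ_{-2} = 0
θ : ℕ → ℤ → ℤ
θ q (+ k) = + geomSum q k
θ q -[1+ _ ] = + 0

-- ⌊ q^e ⌋ for integer e (q ≥ 2 throughout, so ⌊q^e⌋ = 0 for e < 0)
flrPow : ℕ → ℤ → ℤ
flrPow q (+ k) = + (q ℕ.^ k)
flrPow q -[1+ _ ] = + 0

U : (p h q n i : ℕ) → ℤ
U p h q n i =
  ((+ (q ℕ.^ i)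
    ℤ.- ((+ Δ p h q n) ℤ.- + 2) ℤ.* flrPow q ((+ i) ℤ.- + 1))
    ℤ.- ((+ i) ℤ.- + 2) ℤ.* (((+ q) ℤ.- + 1) ℤ.* (+ Δ p h q n) ℤ.+ + 1) ℤ.* flrPow q ((+ i) ℤ.- + 3))
    ℤ.+ θ q ((+ i) ℤ.- + 3)

-- Proof idea: after cancelling θ_i against θ_{i−3} + q^{i−2} + q^{i−1} + q^i, the difference
-- U(n,i,q) − (θ_i − Δq^{i−1} + 1) is 0 for i = 1, q − 2 for i = 2, and
-- q^{i−3}(q² − q − (i−2)((q−1)Δ + 1)) − 1 for i ≥ 3.  With m = n − 2 the hypotheses give
-- (2^m Δ)² ≤ q and 4^m ≤ q, hence t = mΔ satisfies t² ≤ q, so t ≤ q − 3, and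
-- (i−2)((q−1)Δ + 1) ≤ (q−1)t + q ≤ q² − q − 1.

module Submission where

open import Defs
open import Data.Bool using (true; false; T)
open import Data.Integer as ℤ using (ℤ; +_)
open import Data.Integer.Properties as ℤₚ using (pos-*; i≤i+j)
open import Data.Integer.Tactic.RingSolver using (solve-∀; solve)
open import Data.List using (_∷_; [])
open import Data.Nat as ℕ using (ℕ; zero; suc; z≤n; s≤s)
open import Data.Nat.DivMod using (_/_; m/n*n≤m)
open import Data.Nat.Primality using (Prime)
open import Data.Nat.Properties as ℕₚ using (*-identityʳ)
import Data.Nat.Tactic.RingSolver as ℕ-Solver
open import Data.Product using (_×_; _,_; proj₁; proj₂)
open import Relation.Binary.PropositionalEquality
  using (_≡_; refl; cong; cong₂; sym; trans; subst; module ≡-Reasoning)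
open import Relation.Nullary using (yes; no)

module _ where
  open import Data.Integer using (_+_; _-_; _*_)
  open ≡-Reasoning

  -- U(n,i,q) with Δ_{n,q} abstracted to D: U p h q n i is definitionally U′ q (Δ p h q n) i.
  U′ : (q D i : ℕ) → ℤ
  U′ q D i =
    ((+ (q ℕ.^ i) - (+ D - + 2) * flrPow q (+ i - + 1))
      - (+ i - + 2) * ((+ q - + 1) * + D + + 1) * flrPow q (+ i - + 3))
      + θ q (+ i - + 3)

  lowerBound : (q D i : ℕ) → ℤ
  lowerBound q D i = (θ q (+ i) - + (D ℕ.* q ℕ.^ (i ℕ.∸ 1))) + + 1

  -- In each `identity` below the left-hand side is U′ unfolded at the given i, with the
  -- casts of naturals (powers of q, θ) as atoms, so that the ring solver applies.
  U′-1 : ∀ q D → U′ q D 1 ≡ lowerBound q D 1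
  U′-1 q D = begin
    U′ q D 1                           ≡⟨ identity (+ (q ℕ.* 1)) (+ D) ((+ q - + 1) * + D + + 1) ⟩
    (+ (1 ℕ.+ q ℕ.* 1) - + D) + + 1    ≡⟨ cong (λ x → (+ (1 ℕ.+ q ℕ.* 1) - + x) + + 1) (sym (*-identityʳ D)) ⟩
    lowerBound q D 1                   ∎
    where
    identity : ∀ q¹ D C → ((q¹ - (D - + 2) * + 1) - (+ 1 - + 2) * C * + 0) + + 0 ≡ ((+ 1 + q¹) - D) + + 1
    identity = solve-∀

  U′-2 : ∀ q D → U′ q D 2 ≡ lowerBound q D 2 + (+ q - + 2)
  U′-2 q D = begin
    U′ q D 2                                                   ≡⟨ identity (+ q¹) (+ q²) (+ D) ((+ q - + 1) * + D + + 1) ⟩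
    ((+ (1 ℕ.+ q¹ ℕ.+ q²) - + D * + q¹) + + 1) + (+ q¹ - + 2)  ≡⟨ cong₂ (λ x y → ((+ (1 ℕ.+ q¹ ℕ.+ q²) - x) + + 1) + (+ y - + 2))
                                                                       (sym (pos-* D q¹)) (*-identityʳ q) ⟩
    lowerBound q D 2 + (+ q - + 2)                             ∎
    where
    q¹ q² : ℕ
    q¹ = q ℕ.* 1
    q² = q ℕ.* q¹
    identity : ∀ q¹ q² D C →
      ((q² - (D - + 2) * q¹) - (+ 2 - + 2) * C * + 0) + + 0 ≡ (((+ 1 + q¹ + q²) - D * q¹) + + 1) + (q¹ - + 2)
    identity = solve-∀

  U′-3+k : ∀ r D k e → let q = suc r; Q = q ℕ.^ k in
    q ℕ.* Q ℕ.+ 1 ℕ.+ suc k ℕ.* (r ℕ.* D ℕ.+ 1) ℕ.* Q ℕ.+ e ≡ q ℕ.* (q ℕ.* Q) →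
    U′ q D (3 ℕ.+ k) ≡ lowerBound q D (3 ℕ.+ k) + + e
  U′-3+k r D k e gap = begin
    U′ q D (3 ℕ.+ k)                                     ≡⟨ identity (+ G) (+ a) (+ b) (+ c) (+ D) (+ r) (+ k) (+ Q) (+ e) b≡ ⟩
    ((+ (G ℕ.+ a ℕ.+ b ℕ.+ c) - + D * + b) + + 1) + + e  ≡⟨ cong (λ x → ((+ (G ℕ.+ a ℕ.+ b ℕ.+ c) - x) + + 1) + + e) (sym (pos-* D b)) ⟩
    lowerBound q D (3 ℕ.+ k) + + e                       ∎
    where
    q Q G a b c : ℕ
    q = suc r
    Q = q ℕ.^ k
    G = geomSum q k
    a = q ℕ.* Q
    b = q ℕ.* a
    c = q ℕ.* b
    b≡ : + b ≡ + a + + 1 + + suc k * (+ r * + D + + 1) * + Q + + e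
    b≡ = trans (cong +_ (sym gap)) (cong (λ x → + a + + 1 + x + + e)
           (trans (pos-* (suc k ℕ.* (r ℕ.* D ℕ.+ 1)) Q) (cong (_* + Q)
             (trans (pos-* (suc k) (r ℕ.* D ℕ.+ 1)) (cong (λ x → + suc k * (x + + 1)) (pos-* r D))))))
    identity : ∀ G a b c D r k Q e → b ≡ a + + 1 + (+ 1 + k) * (r * D + + 1) * Q + e →
      ((c - (D - + 2) * b) - ((+ 3 + k) - + 2) * (((+ 1 + r) - + 1) * D + + 1) * Q) + G
        ≡ (((G + a + b + c) - D * b) + + 1) + e
    identity G a b c D r k Q e refl = solve (G ∷ a ∷ c ∷ D ∷ r ∷ k ∷ Q ∷ e ∷ [])

open import Data.Nat using (_+_; _*_; _^_; _∸_; _≤_; _<_)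
open ℕₚ
  using (≤-trans; ≤-reflexive; ≤-pred; <⇒≤; m≤m+n; m≤n+m; m≤n*m; m≤m*n; +-monoˡ-≤; +-monoʳ-≤;
         +-mono-≤; *-monoˡ-≤; *-mono-≤; *-cancelˡ-≤; ^-monoʳ-≤; ^-distribˡ-+-*; m^n>0; m^n≢0;
         +-identityʳ; m≤n⇒∃[o]m+o≡n; _≤?_; ≰⇒>; ≤ᵇ⇒≤; m≤n⇒m≤1+n)
open ℕₚ.≤-Reasoning

n<2^n : ∀ n → n < 2 ^ n
n<2^n zero = s≤s z≤n
n<2^n (suc n) = +-mono-≤ (m^n>0 2 n) (≤-trans (n<2^n n) (m≤m+n (2 ^ n) 0))

m*m≤n⇒3+m≤n : ∀ {m n} → m * m ≤ n → 5 ≤ n → 3 + m ≤ n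
m*m≤n⇒3+m≤n {m} m*m≤n 5≤n with m ≤? 2
... | yes m≤2 = ≤-trans (+-monoʳ-≤ 3 m≤2) 5≤n
... | no m≰2 = begin
  3 + m  ≤⟨ +-monoˡ-≤ m 2<m ⟩
  m + m  ≡⟨ cong (λ x → m + x) (sym (+-identityʳ m)) ⟩
  2 * m  ≤⟨ *-monoˡ-≤ m (<⇒≤ 2<m) ⟩
  m * m  ≤⟨ m*m≤n ⟩
  _      ∎
  where
  2<m : 2 < m
  2<m = ≰⇒> m≰2

r*t+2q+1≤q*q : ∀ {r t} → 2 + t ≤ r → r * t + suc r + suc r + 1 ≤ suc r * suc r
r*t+2q+1≤q*q {t = t} 2+t≤r with m≤n⇒∃[o]m+o≡n 2+t≤r
... | e , refl = ≤-trans (m≤m+n _ (2 + 2 * t + e * e + 4 * e + t * e)) (≤-reflexive (ℕ-Solver.solve (t ∷ e ∷ [])))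

coefficient+q+1≤q*q : ∀ {r D m k} → suc k ≤ m → m ≤ suc r → m * D * (m * D) ≤ suc r → 5 ≤ suc r →
  suc k * (r * D + 1) + suc r + 1 ≤ suc r * suc r
coefficient+q+1≤q*q {r} {D} {m} {k} k<m m≤q mD²≤q 5≤q = begin
  suc k * (r * D + 1) + q + 1  ≤⟨ +-monoˡ-≤ 1 (+-monoˡ-≤ q (*-monoˡ-≤ (r * D + 1) k<m)) ⟩
  m * (r * D + 1) + q + 1      ≡⟨ cong (λ x → x + q + 1) (ℕ-Solver.solve (r ∷ D ∷ m ∷ [])) ⟩
  r * (m * D) + m + q + 1      ≤⟨ +-monoˡ-≤ 1 (+-monoˡ-≤ q (+-monoʳ-≤ (r * (m * D)) m≤q)) ⟩
  r * (m * D) + q + q + 1      ≤⟨ r*t+2q+1≤q*q (≤-pred (m*m≤n⇒3+m≤n mD²≤q 5≤q)) ⟩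
  q * q                        ∎
  where
  q : ℕ
  q = suc r

a*Q+1+c*Q≤a*[a*Q] : ∀ {a c Q} → 1 ≤ Q → c + a + 1 ≤ a * a → a * Q + 1 + c * Q ≤ a * (a * Q)
a*Q+1+c*Q≤a*[a*Q] {a} {c} {Q} 1≤Q c+a+1≤a*a = begin
  a * Q + 1 + c * Q  ≤⟨ +-monoˡ-≤ (c * Q) (+-monoʳ-≤ (a * Q) 1≤Q) ⟩
  a * Q + Q + c * Q  ≡⟨ ℕ-Solver.solve (a ∷ c ∷ Q ∷ []) ⟩
  (c + a + 1) * Q    ≤⟨ *-monoˡ-≤ Q c+a+1≤a*a ⟩
  a * a * Q          ≡⟨ ℕ-Solver.solve (a ∷ Q ∷ []) ⟩
  a * (a * Q)        ∎

lowerBound≤U′ : ∀ {q D m i} → 5 ≤ q → m ≤ q → m * D * (m * D) ≤ q → 1 ≤ i → i ≤ 2 + m →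
  lowerBound q D i ℤ.≤ U′ q D i
lowerBound≤U′ {q} {D} {i = 1} _ _ _ _ _ = ℤₚ.≤-reflexive (sym (U′-1 q D))
lowerBound≤U′ {D = D} {i = 2} (s≤s (s≤s {n = s} _)) _ _ _ _ =
  subst (lowerBound (2 + s) D 2 ℤ.≤_) (sym (U′-2 (2 + s) D)) (i≤i+j _ (+ s))
lowerBound≤U′ {suc r} {D} {m} {suc (suc (suc k))} 5≤q m≤q mD²≤q _ (s≤s (s≤s k<m))
  with m≤n⇒∃[o]m+o≡n (a*Q+1+c*Q≤a*[a*Q] (m^n>0 (suc r) k) (coefficient+q+1≤q*q k<m m≤q mD²≤q 5≤q))
... | e , gap = subst (lowerBound (suc r) D (3 + k) ℤ.≤_) (sym (U′-3+k r D k e gap)) (i≤i+j _ (+ e))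

isqrt*isqrt≤ : ∀ m → isqrt m * isqrt m ≤ m
isqrt*isqrt≤ zero = z≤n
isqrt*isqrt≤ (suc m) with isqrt m | isqrt*isqrt≤ m
... | r | r*r≤m with suc r * suc r ℕ.≤ᵇ suc m in eq
... | true = ≤ᵇ⇒≤ _ _ (subst T (sym eq) _)
... | false = m≤n⇒m≤1+n r*r≤m

16*[2^m*⌊x/2^[2+m]⌋]²≤x*x : ∀ x m → let y = 2 ^ m * _/_ x (2 ^ (2 + m)) {{m^n≢0 2 (2 + m)}} in
  16 * (y * y) ≤ x * x
16*[2^m*⌊x/2^[2+m]⌋]²≤x*x x m = begin
  16 * (2 ^ m * z * (2 ^ m * z))      ≡⟨ identity (2 ^ m) z ⟩
  z * 2 ^ (2 + m) * (z * 2 ^ (2 + m)) ≤⟨ *-mono-≤ z*2^[2+m]≤x z*2^[2+m]≤x ⟩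
  x * x                               ∎
  where
  identity : ∀ s z → 16 * (s * z * (s * z)) ≡ z * (2 * (2 * s)) * (z * (2 * (2 * s)))
  identity = ℕ-Solver.solve-∀
  z : ℕ
  z = _/_ x (2 ^ (2 + m)) {{m^n≢0 2 (2 + m)}}
  z*2^[2+m]≤x : z * 2 ^ (2 + m) ≤ x
  z*2^[2+m]≤x = m/n*n≤m x (2 ^ (2 + m)) {{m^n≢0 2 (2 + m)}}

[2^m*Δ]²≤q : ∀ {p h q} m → q ≡ p ^ h → 2 ≤ h →
  let y = 2 ^ m * Δ p h q (2 + m) in y * y ≤ q
[2^m*Δ]²≤q {p} {2} {q} m q≡p² (s≤s (s≤s z≤n)) = begin
  y * y         ≤⟨ m≤n*m (y * y) 16 ⟩
  16 * (y * y)  ≤⟨ 16*[2^m*⌊x/2^[2+m]⌋]²≤x*x p m ⟩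
  p * p         ≡⟨ cong (p *_) (sym (*-identityʳ p)) ⟩
  p ^ 2         ≡⟨ sym q≡p² ⟩
  q             ∎
  where
  y : ℕ
  y = 2 ^ m * Δ p 2 q (2 + m)
[2^m*Δ]²≤q {p} {suc (suc (suc _))} {q} m _ (s≤s (s≤s z≤n)) = *-cancelˡ-≤ 16 (begin
  16 * (y * y)  ≤⟨ 16*[2^m*⌊x/2^[2+m]⌋]²≤x*x (isqrt (16 * q)) m ⟩
  isqrt (16 * q) * isqrt (16 * q) ≤⟨ isqrt*isqrt≤ (16 * q) ⟩
  16 * q        ∎)
  where
  y : ℕ
  y = 2 ^ m * _/_ (isqrt (16 * q)) (2 ^ (2 + m)) {{m^n≢0 2 (2 + m)}}

2*[2+m]≡4+[m+m] : ∀ m → 2 * (2 + m) ≡ 4 + (m + m)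
2*[2+m]≡4+[m+m] = ℕ-Solver.solve-∀

5≤q×2^m*2^m≤q : ∀ {h q} m → 2 ≤ h →
  (2 < h → 32 ≤ q × 2 ^ (2 * (2 + m) ∸ 4) ≤ q) → (h ≡ 2 → 2 ^ (2 * (2 + m)) ≤ q) →
  5 ≤ q × 2 ^ m * 2 ^ m ≤ q
5≤q×2^m*2^m≤q {2} {q} m (s≤s (s≤s z≤n)) _ h≡2⇒ =
  ≤-trans 5≤2^[4+[m+m]] 2^[2n]≤q , ≤-trans 2^m*2^m≤2^[4+[m+m]] 2^[2n]≤q
  where
  2^[2n]≤q : 2 ^ (4 + (m + m)) ≤ q
  2^[2n]≤q = subst (λ e → 2 ^ e ≤ q) (2*[2+m]≡4+[m+m] m) (h≡2⇒ refl)
  5≤2^[4+[m+m]] : 5 ≤ 2 ^ (4 + (m + m))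
  5≤2^[4+[m+m]] = ≤-trans (m≤m+n 5 11) (^-monoʳ-≤ 2 (m≤m+n 4 (m + m)))
  2^m*2^m≤2^[4+[m+m]] : 2 ^ m * 2 ^ m ≤ 2 ^ (4 + (m + m))
  2^m*2^m≤2^[4+[m+m]] = ≤-trans (≤-reflexive (sym (^-distribˡ-+-* 2 m m))) (^-monoʳ-≤ 2 (m≤n+m (m + m) 4))
5≤q×2^m*2^m≤q {suc (suc (suc _))} {q} m (s≤s (s≤s z≤n)) h>2⇒ _ with h>2⇒ (s≤s (s≤s (s≤s z≤n)))
... | 32≤q , 2^[2n∸4]≤q =
  ≤-trans (m≤m+n 5 27) 32≤q , subst (_≤ q) 2^[2n∸4]≡2^m*2^m 2^[2n∸4]≤q
  where
  2^[2n∸4]≡2^m*2^m : 2 ^ (2 * (2 + m) ∸ 4) ≡ 2 ^ m * 2 ^ m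
  2^[2n∸4]≡2^m*2^m = trans (cong (λ e → 2 ^ (e ∸ 4)) (2*[2+m]≡4+[m+m] m)) (^-distribˡ-+-* 2 m m)

proposition2p5 : (p h n q : ℕ) → Prime p → q ≡ p ^ h → 2 ≤ h → 3 ≤ n →
    (2 < h → 32 ≤ q × 2 ^ (2 * n ∸ 4) ≤ q) → (h ≡ 2 → 2 ^ (2 * n) ≤ q) →
    (i : ℕ) → 1 ≤ i → i ≤ n →
    ((θ q (+ i) ℤ.- + (Δ p h q n * q ^ (i ∸ 1))) ℤ.+ + 1 ℤ.≤ U p h q n i)
    × (i ≡ 1 → (θ q (+ i) ℤ.- + (Δ p h q n * q ^ (i ∸ 1))) ℤ.+ + 1 ≡ U p h q n i)
proposition2p5 p h (suc (suc m)) q _ q≡pʰ 2≤h (s≤s (s≤s _)) h>2⇒ h≡2⇒ i 1≤i i≤n =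
  lowerBound≤U′ 5≤q m≤q [mD]²≤q 1≤i i≤n , λ { refl → sym (U′-1 q D) }
  where
  D : ℕ
  D = Δ p h q (2 + m)
  bounds : 5 ≤ q × 2 ^ m * 2 ^ m ≤ q
  bounds = 5≤q×2^m*2^m≤q m 2≤h h>2⇒ h≡2⇒
  5≤q : 5 ≤ q
  5≤q = proj₁ bounds
  m≤2^m : m ≤ 2 ^ m
  m≤2^m = <⇒≤ (n<2^n m)
  m≤q : m ≤ q
  m≤q = ≤-trans m≤2^m (≤-trans (m≤m*n (2 ^ m) (2 ^ m) {{m^n≢0 2 m}}) (proj₂ bounds))
  [mD]²≤q : m * D * (m * D) ≤ q
  [mD]²≤q = ≤-trans (*-mono-≤ mD≤2^mD mD≤2^mD) ([2^m*Δ]²≤q m q≡pʰ 2≤h)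
    where
    mD≤2^mD : m * D ≤ 2 ^ m * D
    mD≤2^mD = *-monoˡ-≤ D m≤2^m
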